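{- Let $k\ge 1$ be an integer and let $T$ be a finite tree. If the diameter of $T$ is at least $2k$, then $T$ contains a $k$-leaf.
   Context: In a tree, $k$-leaves are defined recursively: a vertex is a $0$-leaf iff it is a leaf; for $k>0$, a vertex $v$ is a $k$-leaf iff $v$ is adjacent to a $(k-1)$-leaf and all but at most one of the neighbours of $v$ are $t$-leaves for some $t<k$. -}

module Defs where

open import Data.Nat using (ℕ; zero; suc; _≤_)
open import Data.Fin using (Fin)
open import Data.List using (List; []; _∷_; _++_; [_]; length)
open import Data.List.Relation.Unary.Unique.Propositional using (Unique)
open import Data.Product using (Σ; ∃; _×_; _,_)
open import Data.Sum using (_⊎_)
open import Data.Empty using (⊥)
open import Data.Unit using (⊤)
open import Relation.Nullary using (¬_; Dec)
open import Relation.Binary.PropositionalEquality using (_≡_; _≢_)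

record Graph : Set₁ where
  field
    n      : ℕ
    Adj    : Fin n → Fin n → Set
    adj?   : ∀ u v → Dec (Adj u v)
    sym    : ∀ {u v} → Adj u v → Adj v u
    irrefl : ∀ {u} → ¬ Adj u u

module _ (G : Graph) where
  open Graph G

  V : Set
  V = Fin n

  data Walk : V → V → ℕ → Set where
    here : ∀ {u} → Walk u u 0
    step : ∀ {u w v ℓ} → Adj u w → Walk w v ℓ → Walk u v (suc ℓ)

  Connected : Set
  Connected = ∀ u v → ∃ λ ℓ → Walk u v ℓ

  Chain : List V → Set
  Chain []           = ⊤
  Chain (x ∷ [])     = ⊤
  Chain (x ∷ y ∷ xs) = Adj x y × Chain (y ∷ xs)

  -- a cycle: distinct vertices x, ys…, y (at least 3), consecutive ones
  -- adjacent, and y adjacent to x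
  HasCycle : Set
  HasCycle = Σ V λ x → Σ V λ y → Σ (List V) λ ys →
    1 ≤ length ys × Chain (x ∷ ys ++ [ y ]) × Unique (x ∷ ys ++ [ y ]) × Adj y x

  IsTree : Set
  IsTree = Connected × ¬ HasCycle

  DistAtLeast : V → V → ℕ → Set
  DistAtLeast u v d = ∀ ℓ → Walk u v ℓ → d ≤ ℓ

  DiameterAtLeast : ℕ → Set
  DiameterAtLeast d = Σ V λ u → Σ V λ v → DistAtLeast u v d

  IsLeaf : V → Set
  IsLeaf v = Σ V λ u → Adj v u × (∀ w → Adj v w → w ≡ u)

  mutual
    KLeaf : ℕ → V → Set
    KLeaf zero    v = IsLeaf v
    KLeaf (suc k) v =
      (Σ V λ u → Adj v u × KLeaf k u) ×
      -- all but at most one neighbour (namely possibly w) are t-leaves, t < suc k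
      (Σ V λ w → ∀ u → Adj v u → u ≢ w → LeafBelow (suc k) u)

    LeafBelow : ℕ → V → Set
    LeafBelow zero    u = ⊥
    LeafBelow (suc k) u = KLeaf k u ⊎ LeafBelow k u

{-# OPTIONS --safe #-}
-- For an edge x p, say x has height h away from p if the longest non-backtracking walk that
-- starts at x and does not step to p has exactly h edges. Such an x is an h-leaf: the first
-- step of a longest walk reaches a neighbour of height h - 1 away from x, and every neighbour
-- other than p has height below h away from x, so p is the one exceptional neighbour. In an
-- acyclic graph non-backtracking walks are paths, so heights are below the number of vertices;
-- hence from a vertex of height at least k one can follow longest walks down to a vertex of
-- height exactly k. Height at least k is supplied by the second vertex of a non-backtracking
-- walk between two vertices at distance at least 2k > k.
module Submission where

open import Defs
open import Data.Nat using (ℕ; zero; suc; _≤_; _≤?_; _<_; _*_; _+_; z≤n; s≤s)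
open import Data.Nat.Properties using (≤-trans; ≰⇒>; +-suc; +-mono-≤; m≤m+n; m≤n*m; m+1+n≰m)
open import Data.Fin using (Fin; _≟_) renaming (zero to fzero; suc to fsuc; _<_ to _<ᶠ_)
open import Data.Fin.Properties using (any?; pigeonhole)
open import Data.List using (List; []; _∷_; _++_; [_]; length; lookup)
open import Data.List.Properties using (++-assoc)
open import Data.List.Relation.Unary.All as All using (All; []; _∷_)
open import Data.List.Relation.Unary.All.Properties using (++⁻ˡ; ¬Any⇒All¬)
open import Data.List.Relation.Unary.AllPairs using ([]; _∷_)
open import Data.List.Relation.Unary.Unique.Propositional using (Unique)
open import Data.List.Membership.Propositional.Properties using (∈-∃++; ∈-lookup)
open import Data.Product using (Σ; ∃-syntax; _×_; _,_)
open import Data.Sum using (inj₁; inj₂)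
open import Data.Empty using (⊥-elim)
open import Data.Unit using (⊤; tt)
open import Relation.Nullary using (¬_; Dec; yes; no)
open import Relation.Nullary.Decidable using (_×-dec_; ¬?)
open import Relation.Binary.PropositionalEquality using (_≡_; _≢_; refl; sym; subst)

Unique-++⁻ˡ : ∀ {A : Set} (xs : List A) {ys} → Unique (xs ++ ys) → Unique xs
Unique-++⁻ˡ []       _           = []
Unique-++⁻ˡ (x ∷ xs) (x∉ ∷ uniq) = ++⁻ˡ xs x∉ ∷ Unique-++⁻ˡ xs uniq

Unique⇒lookup-≢ : ∀ {A : Set} {xs : List A} → Unique xs →
                  ∀ {i j} → i <ᶠ j → lookup xs i ≢ lookup xs j
Unique⇒lookup-≢ (x∉ ∷ _)    {fzero}  {fsuc j} _         = All.lookup x∉ (∈-lookup j)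
Unique⇒lookup-≢ (_ ∷ uniq) {fsuc i} {fsuc j} (s≤s i<j) = Unique⇒lookup-≢ uniq i<j

Unique⇒length≤ : ∀ {n} {xs : List (Fin n)} → Unique xs → length xs ≤ n
Unique⇒length≤ {n} {xs} uniq with length xs ≤? n
... | yes len≤n = len≤n
... | no  len≰n with i , j , i<j , same ← pigeonhole (≰⇒> len≰n) (lookup xs) =
  ⊥-elim (Unique⇒lookup-≢ uniq i<j same)

suc≤double : ∀ {k} → 1 ≤ k → suc k ≤ 2 * k
suc≤double {k} 1≤k = +-mono-≤ 1≤k (m≤n*m k 1)

∃-boundary : ∀ {P : ℕ → Set} → (∀ t → Dec (P t)) → ∀ j {k} → P k → ¬ P (j + k) →
             ∃[ m ] P (m + k) × ¬ P (suc (m + k))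
∃-boundary P? zero    pk ¬pj = ⊥-elim (¬pj pk)
∃-boundary P? (suc j) {k} pk ¬pj with P? (j + k)
... | yes pj   = j , pj , ¬pj
... | no  ¬pj′ = ∃-boundary P? j pk ¬pj′

module _ (T : Graph) where
  open Graph T renaming (sym to adj-sym)
  open import Data.List.Membership.DecPropositional (_≟_ {n}) using (_∈?_)

  adj⇒≢ : ∀ {x y} → Adj x y → y ≢ x
  adj⇒≢ x~y refl = irrefl x~y

  Chain-++⁻ˡ : ∀ (xs : List (V T)) {ys} → Chain T (xs ++ ys) → Chain T xs
  Chain-++⁻ˡ []           _              = tt
  Chain-++⁻ˡ (x ∷ [])     _              = tt
  Chain-++⁻ˡ (x ∷ y ∷ xs) (x~y , chain) = x~y , Chain-++⁻ˡ (y ∷ xs) chain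

  -- In a tree with an edge x p: the component of x in T - xp has height at least t at x.
  HeightAtLeast : ℕ → V T → V T → Set
  HeightAtLeast zero    x p = ⊤
  HeightAtLeast (suc t) x p = ∃[ u ] Adj x u × u ≢ p × HeightAtLeast t u x

  heightAtLeast? : ∀ t x p → Dec (HeightAtLeast t x p)
  heightAtLeast? zero    x p = yes tt
  heightAtLeast? (suc t) x p =
    any? λ u → adj? x u ×-dec ¬? (u ≟ p) ×-dec heightAtLeast? t u x

  HeightAtLeast-≤ : ∀ {s t x p} → s ≤ t → HeightAtLeast t x p → HeightAtLeast s x p
  HeightAtLeast-≤ z≤n       _                    = tt
  HeightAtLeast-≤ (s≤s s≤t) (u , x~u , u≢p , hu) = u , x~u , u≢p , HeightAtLeast-≤ s≤t hu

  ExactHeight : ℕ → V T → V T → Set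
  ExactHeight h x p = HeightAtLeast h x p × ¬ HeightAtLeast (suc h) x p

  mutual
    exactHeight⇒KLeaf : ∀ h {x p} → Adj x p → ExactHeight h x p → KLeaf T h x
    exactHeight⇒KLeaf zero {x} {p} x~p (_ , ¬h1) = p , x~p , onlyNeighbour
      where
      onlyNeighbour : ∀ w → Adj x w → w ≡ p
      onlyNeighbour w x~w with w ≟ p
      ... | yes w≡p = w≡p
      ... | no  w≢p = ⊥-elim (¬h1 (w , x~w , w≢p , tt))
    exactHeight⇒KLeaf (suc h) {x} {p} x~p ((u , x~u , u≢p , hu) , ¬hx) =
      (u , x~u , exactHeight⇒KLeaf h (adj-sym x~u) (hu , λ hu′ → ¬hx (u , x~u , u≢p , hu′))) ,
      (p , λ v x~v v≢p → height<⇒LeafBelow h (adj-sym x~v) λ hv → ¬hx (v , x~v , v≢p , hv))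

    height<⇒LeafBelow : ∀ h {x p} → Adj x p → ¬ HeightAtLeast (suc h) x p → LeafBelow T (suc h) x
    height<⇒LeafBelow h {x} {p} x~p ¬hx with heightAtLeast? h x p
    ... | yes hx = inj₁ (exactHeight⇒KLeaf h x~p (hx , ¬hx))
    height<⇒LeafBelow zero    x~p ¬hx | no ¬h0 = ⊥-elim (¬h0 tt)
    height<⇒LeafBelow (suc h) x~p ¬hx | no ¬hx′ = inj₂ (height<⇒LeafBelow h x~p ¬hx′)

  exactHeight-descend : ∀ m {k x p} → Adj x p → ExactHeight (m + k) x p →
                        ∃[ y ] ∃[ q ] Adj y q × ExactHeight k y q
  exactHeight-descend zero    x~p hx = _ , _ , x~p , hx
  exactHeight-descend (suc m) x~p ((u , x~u , u≢p , hu) , ¬hx) =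
    exactHeight-descend m (adj-sym x~u) (hu , λ hu′ → ¬hx (u , x~u , u≢p , hu′))

  -- The list x ∷ p ∷ rest is a path traced backwards; a new vertex on it would close a cycle.
  fresh-neighbour : ¬ HasCycle T → ∀ {x p v} rest → Unique (x ∷ p ∷ rest) → Chain T (x ∷ p ∷ rest) →
                    Adj x v → v ≢ p → All (v ≢_) (x ∷ p ∷ rest)
  fresh-neighbour acyclic {x} {p} {v} rest uniq chain x~v v≢p with v ∈? rest
  ... | no  v∉rest = adj⇒≢ x~v ∷ v≢p ∷ ¬Any⇒All¬ rest v∉rest
  ... | yes v∈rest with as , bs , refl ← ∈-∃++ v∈rest =
    ⊥-elim (acyclic (x , v , p ∷ as , s≤s z≤n ,
                     Chain-++⁻ˡ (x ∷ p ∷ as ++ [ v ]) (subst (λ l → Chain T (x ∷ p ∷ l)) split chain) ,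
                     Unique-++⁻ˡ (x ∷ p ∷ as ++ [ v ]) (subst (λ l → Unique (x ∷ p ∷ l)) split uniq) ,
                     adj-sym x~v))
    where
    split : as ++ v ∷ bs ≡ (as ++ [ v ]) ++ bs
    split = sym (++-assoc as [ v ] bs)

  height+length≤n : ¬ HasCycle T → ∀ t {x p} rest → HeightAtLeast t x p →
                    Unique (x ∷ p ∷ rest) → Chain T (x ∷ p ∷ rest) → t + length (x ∷ p ∷ rest) ≤ n
  height+length≤n acyclic zero    rest _ uniq _ = Unique⇒length≤ uniq
  height+length≤n acyclic (suc t) {x} {p} rest (v , x~v , v≢p , hv) uniq chain =
    subst (_≤ n) (+-suc t (length (x ∷ p ∷ rest)))
      (height+length≤n acyclic t (p ∷ rest) hv
        (fresh-neighbour acyclic rest uniq chain x~v v≢p ∷ uniq) (adj-sym x~v , chain))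

  acyclic⇒height<n : ¬ HasCycle T → ∀ {x p} → Adj x p → ¬ HeightAtLeast n x p
  acyclic⇒height<n acyclic x~p hx =
    m+1+n≰m n (height+length≤n acyclic n [] hx ((adj⇒≢ (adj-sym x~p) ∷ []) ∷ [] ∷ []) (x~p , tt))

  heightAtLeast⇒KLeaf : ¬ HasCycle T → ∀ k {x p} → Adj x p → HeightAtLeast k x p → ∃[ y ] KLeaf T k y
  heightAtLeast⇒KLeaf acyclic k {x} {p} x~p hx
    with m , hx′ , ¬hx′ ← ∃-boundary (λ t → heightAtLeast? t x p) n hx
                            (λ h → acyclic⇒height<n acyclic x~p (HeightAtLeast-≤ (m≤m+n n k) h))
    with y , q , y~q , hy ← exactHeight-descend m x~p (hx′ , ¬hx′)
    = y , exactHeight⇒KLeaf k y~q hy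

  -- NBWalk p x v ℓ: a non-backtracking walk of length ℓ from x to v whose first step avoids p;
  -- taking p = x imposes nothing on the first step.
  data NBWalk : V T → V T → V T → ℕ → Set where
    stop : ∀ {p x} → NBWalk p x x 0
    go   : ∀ {p x y v ℓ} → Adj x y → y ≢ p → NBWalk x y v ℓ → NBWalk p x v (suc ℓ)

  NBWalk-forget : ∀ {p x v ℓ} → NBWalk p x v ℓ → NBWalk x x v ℓ
  NBWalk-forget stop            = stop
  NBWalk-forget (go x~y _ walk) = go x~y (adj⇒≢ x~y) walk

  walk⇒NBWalk : ∀ {u v ℓ} → Walk T u v ℓ → ∃[ ℓ′ ] NBWalk u u v ℓ′
  walk⇒NBWalk here = 0 , stop
  walk⇒NBWalk {u} (step u~w walk) with walk⇒NBWalk walk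
  ... | _ , stop = _ , go u~w (adj⇒≢ u~w) stop
  ... | _ , go {y = y} w~y y≢w nb with y ≟ u
  ...   | yes refl = _ , NBWalk-forget nb
  ...   | no  y≢u  = _ , go u~w (adj⇒≢ u~w) (go w~y y≢u nb)

  NBWalk⇒Walk : ∀ {p x v ℓ} → NBWalk p x v ℓ → Walk T x v ℓ
  NBWalk⇒Walk stop          = here
  NBWalk⇒Walk (go x~y _ nb) = step x~y (NBWalk⇒Walk nb)

  NBWalk⇒HeightAtLeast : ∀ {p x v ℓ t} → NBWalk p x v ℓ → t ≤ ℓ → HeightAtLeast t x p
  NBWalk⇒HeightAtLeast _                        z≤n      = tt
  NBWalk⇒HeightAtLeast (go {y = y} x~y y≢p nb) (s≤s t≤ℓ) = y , x~y , y≢p , NBWalk⇒HeightAtLeast nb t≤ℓ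

  NBWalk⇒KLeaf : ¬ HasCycle T → ∀ k {p u v ℓ} → NBWalk p u v ℓ → k < ℓ → ∃[ y ] KLeaf T k y
  NBWalk⇒KLeaf acyclic k (go u~y _ nb) (s≤s k≤ℓ) =
    heightAtLeast⇒KLeaf acyclic k (adj-sym u~y) (NBWalk⇒HeightAtLeast nb k≤ℓ)

mainTheorem7 : (k : ℕ) → 1 ≤ k → (T : Graph) → IsTree T →
    DiameterAtLeast T (2 * k) → Σ (V T) λ v → KLeaf T k v
mainTheorem7 k 1≤k T (connected , acyclic) (u , v , far)
  with ℓ , walk ← connected u v
  with ℓ′ , nb ← walk⇒NBWalk T walk
  = NBWalk⇒KLeaf T acyclic k nb (≤-trans (suc≤double 1≤k) (far ℓ′ (NBWalk⇒Walk T nb)))
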